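{- Fix $\vec{k}=(k_1,\dots,k_n)\in\mathbb{N}^n$ and, for integers $r\ge 0$ and $s$ with $\binom{s}{k_d}\ne 0$ for all $d$, define $$\rho_{\vec{k}}(r,s):=\nabla^r\Big[\prod_{d=1}^n\frac{\binom{x}{k_d}}{\binom{s}{k_d}}\Big]_{x=s}.$$ Then $\rho_{\vec k}(0,s)=1$, and (whenever both sides are defined) $\rho_{\vec k}$ satisfies the recursion $$\rho_{\vec{k}}(r,s)=\rho_{\vec{k}}(r-1,s)-\Big(\prod_{d=1}^n\Big(1-\frac{k_d}{s}\Big)\Big)\rho_{\vec{k}}(r-1,s-1)\qquad(r\ge 1).$$ Moreover, for $0\le \max_{d\in[n]}k_d\le r\le s$, $$\rho_{\vec{k}}(r,s)={}_{n+1}F_{n}\!\left(\begin{matrix}-r,\;k_1-s,\;\dots,\;k_n-s\\ -s,\;\dots,\;-s\end{matrix};1\right),$$ where the lower parameter $-s$ is repeated $n$ times.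
   Context: $\nabla$ is the backward difference operator $\nabla f(x)=f(x)-f(x-1)$, with $\nabla^r$ its $r$-fold iterate and $[g(x)]_{x=a}$ denoting evaluation at $x=a$; $\binom{x}{k}=x(x-1)\cdots(x-k+1)/k!$. The generalized hypergeometric function is ${}_pF_q\!\left(\begin{smallmatrix}a_1,\dots,a_p\\ b_1,\dots,b_q\end{smallmatrix};t\right)=\sum_{j\ge 0}\frac{\prod_{i}(a_i)^{(j)}}{\prod_i (b_i)^{(j)}}\frac{t^j}{j!}$, where $(a)^{(j)}=a(a+1)\cdots(a+j-1)$ is the rising factorial (the sum terminates when an upper parameter is a nonpositive integer). -}

module Defs where

open import Data.Nat as ℕ using (ℕ; zero; suc)
open import Data.Nat using (_!)
open import Data.Integer as ℤ using (ℤ; +_)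
open import Data.Fin using (Fin; zero; suc)
open import Data.Rational using (ℚ; 0ℚ; 1ℚ; _+_; _*_; _-_; -_; 1/_; _/_; ≢-nonZero)
open import Data.Rational.Properties using (_≟_)
open import Relation.Nullary using (yes; no)

ℤtoℚ : ℤ → ℚ
ℤtoℚ z = z / 1

ℕtoℚ : ℕ → ℚ
ℕtoℚ n = ℤtoℚ (+ n)

-- total inverse (convention 1/0 = 0); only used where the paper's
-- denominators are nonzero (guaranteed by hypotheses)
inv : ℚ → ℚ
inv q with q ≟ 0ℚ
... | yes _ = 0ℚ
... | no q≢0 = 1/_ q {{≢-nonZero q≢0}}

prodFin : (n : ℕ) → (Fin n → ℚ) → ℚ
prodFin zero    f = 1ℚ
prodFin (suc n) f = f zero * prodFin n (λ d → f (suc d))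

sumUpTo : ℕ → (ℕ → ℚ) → ℚ
sumUpTo zero    f = f 0
sumUpTo (suc N) f = sumUpTo N f + f (suc N)

pow : ℚ → ℕ → ℚ
pow t zero    = 1ℚ
pow t (suc j) = pow t j * t

falling : ℚ → ℕ → ℚ
falling x zero    = 1ℚ
falling x (suc k) = falling x k * (x - ℕtoℚ k)

rising : ℚ → ℕ → ℚ
rising a zero    = 1ℚ
rising a (suc j) = rising a j * (a + ℕtoℚ j)

binom : ℤ → ℕ → ℚ
binom x k = falling (ℤtoℚ x) k * inv (ℕtoℚ (k !))

nabla : (ℤ → ℚ) → (ℤ → ℚ)
nabla f x = f x - f (x ℤ.- ℤ.1ℤ)

nablaPow : ℕ → (ℤ → ℚ) → (ℤ → ℚ)
nablaPow zero    f = f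
nablaPow (suc r) f = nabla (nablaPow r f)

rho : {n : ℕ} → (Fin n → ℕ) → ℕ → ℤ → ℚ
rho {n} k r s =
  nablaPow r (λ x → prodFin n (λ d → binom x (k d) * inv (binom s (k d)))) s

-- terminating generalized hypergeometric series pFq(a; b; t), summed
-- over j = 0..N (N is chosen so that an upper parameter equals -N,
-- so all terms with j > N vanish)
hypF : (p q : ℕ) → (Fin p → ℚ) → (Fin q → ℚ) → ℕ → ℚ → ℚ
hypF p q a b N t =
  sumUpTo N (λ j → prodFin p (λ i → rising (a i) j)
                   * inv (prodFin q (λ i → rising (b i) j))
                   * pow t j * inv (ℕtoℚ (j !)))

upperParams : {n : ℕ} → (Fin n → ℕ) → ℕ → ℕ → Fin (suc n) → ℚ
upperParams k r s zero    = - ℕtoℚ r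
upperParams k r s (suc d) = ℕtoℚ (k d) - ℕtoℚ s

module Submission where

-- The argument has three ingredients, developed after some basic
-- arithmetic in ℚ (casts from ℤ, the total inverse, finite products and sums,
-- falling and rising factorials):
--   * Newton's expansion ∇^r f(s) = Σ_{j ≤ r} ((-r)^{(j)}/j!) f(s-j),
--     proved by induction on r from the Pascal rule for the coefficients;
--   * the binomial ratio identities
--       binom(s-1,k) = (1 - k/s) binom(s,k)       (lowering s by one),
--       binom(s-j,k)/binom(s,k) = (k-s)^{(j)}/(-s)^{(j)}   (0 ≤ j,k ≤ s),
--     both consequences of falling(x, j+k) = falling(x,j) falling(x-j,k);
--   * linearity of ∇^r.
-- The recursion follows from ∇^{r+1} F(s) = ∇^r F(s) - ∇^r F(s-1) and the
-- first ratio identity: the product normalised at s is ∏_d (1 - k_d/s) times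
-- the product normalised at s-1, so by linearity the second term is that
-- constant times ρ_k(r,s-1).  The hypergeometric formula follows by expanding
-- ∇^r with Newton's formula and rewriting each summand with the second ratio
-- identity.

open import Defs
open import Data.Nat as ℕ using (ℕ; zero; suc; _≤_; _<_; z≤n; _!)
import Data.Nat.Properties as ℕP
open import Data.Integer as ℤ using (ℤ; +_; 1ℤ)
import Data.Integer.Properties as ℤP
import Data.Integer.Solver as ℤSolver
open import Data.Rational as ℚ using (ℚ; 0ℚ; 1ℚ; _+_; _*_; _-_; -_)
import Data.Rational.Properties as ℚP
import Data.Rational.Unnormalised as ℚᵘ
import Data.Rational.Unnormalised.Properties as ℚᵘP
open import Data.Rational.Solver using (module +-*-Solver)
open import Data.Fin using (Fin; zero; suc)
open import Data.Product using (_×_; _,_)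
open import Data.Empty using (⊥-elim)
open import Relation.Nullary using (Dec; yes; no)
open import Relation.Binary.PropositionalEquality
open ≡-Reasoning
open +-*-Solver

-- Casts.  ℤtoℚ z is the normalisation of the fraction z/1, so the ring laws
-- of ℤ transfer to it through the unnormalised rationals.

toℚᵘ-ℤtoℚ : ∀ z → ℚ.toℚᵘ (ℤtoℚ z) ℚᵘ.≃ ℚᵘ.mkℚᵘ z 0
toℚᵘ-ℤtoℚ z = ℚP.toℚᵘ-fromℚᵘ (ℚᵘ.mkℚᵘ z 0)

ℤtoℚ-+ : ∀ a b → ℤtoℚ (a ℤ.+ b) ≡ ℤtoℚ a + ℤtoℚ b
ℤtoℚ-+ a b = ℚP.toℚᵘ-injective
  (ℚᵘP.≃-trans (toℚᵘ-ℤtoℚ (a ℤ.+ b)) (ℚᵘP.≃-trans fractions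
    (ℚᵘP.≃-sym (ℚᵘP.≃-trans (ℚP.toℚᵘ-homo-+ (ℤtoℚ a) (ℤtoℚ b))
                            (ℚᵘP.+-cong (toℚᵘ-ℤtoℚ a) (toℚᵘ-ℤtoℚ b))))))
  where
  open ℤSolver.+-*-Solver using () renaming (solve to solveℤ; _:=_ to _:=ℤ_; _:+_ to _:+ℤ_; _:*_ to _:*ℤ_; con to conℤ)
  fractions : ℚᵘ.mkℚᵘ (a ℤ.+ b) 0 ℚᵘ.≃ ℚᵘ.mkℚᵘ a 0 ℚᵘ.+ ℚᵘ.mkℚᵘ b 0
  fractions = ℚᵘ.*≡* (solveℤ 2 (λ a b → (a :+ℤ b) :*ℤ conℤ (+ 1)
                                   :=ℤ (a :*ℤ conℤ (+ 1) :+ℤ b :*ℤ conℤ (+ 1)) :*ℤ conℤ (+ 1)) refl a b)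

ℤtoℚ-* : ∀ a b → ℤtoℚ (a ℤ.* b) ≡ ℤtoℚ a * ℤtoℚ b
ℤtoℚ-* a b = ℚP.toℚᵘ-injective
  (ℚᵘP.≃-trans (toℚᵘ-ℤtoℚ (a ℤ.* b)) (ℚᵘP.≃-trans fractions
    (ℚᵘP.≃-sym (ℚᵘP.≃-trans (ℚP.toℚᵘ-homo-* (ℤtoℚ a) (ℤtoℚ b))
                            (ℚᵘP.*-cong (toℚᵘ-ℤtoℚ a) (toℚᵘ-ℤtoℚ b))))))
  where
  fractions : ℚᵘ.mkℚᵘ (a ℤ.* b) 0 ℚᵘ.≃ ℚᵘ.mkℚᵘ a 0 ℚᵘ.* ℚᵘ.mkℚᵘ b 0
  fractions = ℚᵘ.*≡* refl

ℤtoℚ-neg : ∀ a → ℤtoℚ (ℤ.- a) ≡ - ℤtoℚ a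
ℤtoℚ-neg a = ℚP.toℚᵘ-injective
  (ℚᵘP.≃-trans (toℚᵘ-ℤtoℚ (ℤ.- a))
    (ℚᵘP.≃-sym (ℚᵘP.≃-trans (ℚP.toℚᵘ-homo‿- (ℤtoℚ a)) (ℚᵘP.-‿cong (toℚᵘ-ℤtoℚ a)))))

ℤtoℚ-sub : ∀ a b → ℤtoℚ (a ℤ.- b) ≡ ℤtoℚ a - ℤtoℚ b
ℤtoℚ-sub a b = trans (ℤtoℚ-+ a (ℤ.- b)) (cong (λ t → ℤtoℚ a + t) (ℤtoℚ-neg b))

ℤtoℚ-injective : ∀ a b → ℤtoℚ a ≡ ℤtoℚ b → a ≡ b
ℤtoℚ-injective a b eq
  with ℚᵘP.≃-trans (ℚᵘP.≃-sym (toℚᵘ-ℤtoℚ a))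
         (ℚᵘP.≃-trans (ℚᵘP.≃-reflexive (cong ℚ.toℚᵘ eq)) (toℚᵘ-ℤtoℚ b))
... | ℚᵘ.*≡* a*1≡b*1 = trans (sym (ℤP.*-identityʳ a)) (trans a*1≡b*1 (ℤP.*-identityʳ b))

ℕtoℚ-* : ∀ m n → ℕtoℚ (m ℕ.* n) ≡ ℕtoℚ m * ℕtoℚ n
ℕtoℚ-* m n = trans (cong ℤtoℚ (ℤP.pos-* m n)) (ℤtoℚ-* (+ m) (+ n))

ℕtoℚ-suc : ∀ n → ℕtoℚ (suc n) ≡ ℕtoℚ n + 1ℚ
ℕtoℚ-suc n = trans (ℤtoℚ-+ (+ 1) (+ n)) (ℚP.+-comm 1ℚ (ℕtoℚ n))

ℕtoℚ-injective : ∀ m n → ℕtoℚ m ≡ ℕtoℚ n → m ≡ n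
ℕtoℚ-injective m n eq = ℤP.+-injective (ℤtoℚ-injective (+ m) (+ n) eq)

inv-cancelʳ : ∀ q → q ≢ 0ℚ → q * inv q ≡ 1ℚ
inv-cancelʳ q q≢0 with q ℚP.≟ 0ℚ
... | yes q≡0  = ⊥-elim (q≢0 q≡0)
... | no  q≢0′ = ℚP.*-inverseʳ q {{ℚ.≢-nonZero q≢0′}}

*-unitʳ-by : ∀ a {u} → u ≡ 1ℚ → a ≡ a * u
*-unitʳ-by a u≡1 = trans (sym (ℚP.*-identityʳ a)) (cong (a *_) (sym u≡1))

≢0-cancelˡ : ∀ a b → a ≢ 0ℚ → a * b ≡ 0ℚ → b ≡ 0ℚ
≢0-cancelˡ a b a≢0 ab≡0 = begin
  b                 ≡⟨ *-unitʳ-by b (trans (ℚP.*-comm (inv a) a) (inv-cancelʳ a a≢0)) ⟩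
  b * (inv a * a)   ≡⟨ solve 3 (λ b i a → b :* (i :* a) := i :* (a :* b)) refl b (inv a) a ⟩
  inv a * (a * b)   ≡⟨ cong (inv a *_) ab≡0 ⟩
  inv a * 0ℚ        ≡⟨ ℚP.*-zeroʳ (inv a) ⟩
  0ℚ                ∎

*-≢0 : ∀ {a b} → a ≢ 0ℚ → b ≢ 0ℚ → a * b ≢ 0ℚ
*-≢0 {a} {b} a≢0 b≢0 ab≡0 = b≢0 (≢0-cancelˡ a b a≢0 ab≡0)

inv-≢0 : ∀ q → q ≢ 0ℚ → inv q ≢ 0ℚ
inv-≢0 q q≢0 inv≡0 = ℚP.1≢0 (trans (sym (inv-cancelʳ q q≢0)) (trans (cong (q *_) inv≡0) (ℚP.*-zeroʳ q)))

inv-unique : ∀ x y → x * y ≡ 1ℚ → inv x ≡ y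
inv-unique x y xy≡1 = begin
  inv x               ≡⟨ *-unitʳ-by (inv x) xy≡1 ⟩
  inv x * (x * y)     ≡⟨ solve 3 (λ i x y → i :* (x :* y) := y :* (x :* i)) refl (inv x) x y ⟩
  y * (x * inv x)     ≡⟨ cong (y *_) (inv-cancelʳ x x≢0) ⟩
  y * 1ℚ              ≡⟨ ℚP.*-identityʳ y ⟩
  y                   ∎
  where
  x≢0 : x ≢ 0ℚ
  x≢0 x≡0 = ℚP.1≢0 (trans (sym xy≡1) (trans (cong (_* y) x≡0) (ℚP.*-zeroˡ y)))

-- inv is multiplicative, including the degenerate cases thanks to inv 0 = 0.
inv-* : ∀ a b → inv (a * b) ≡ inv a * inv b
inv-* a b = by-cases (a ℚP.≟ 0ℚ) (b ℚP.≟ 0ℚ)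
  where
  by-cases : Dec (a ≡ 0ℚ) → Dec (b ≡ 0ℚ) → inv (a * b) ≡ inv a * inv b
  by-cases (yes a≡0) _ =
    trans (cong inv (trans (cong (_* b) a≡0) (ℚP.*-zeroˡ b)))
          (sym (trans (cong (λ t → inv t * inv b) a≡0) (ℚP.*-zeroˡ (inv b))))
  by-cases (no _) (yes b≡0) =
    trans (cong inv (trans (cong (a *_) b≡0) (ℚP.*-zeroʳ a)))
          (sym (trans (cong (λ t → inv a * inv t) b≡0) (ℚP.*-zeroʳ (inv a))))
  by-cases (no a≢0) (no b≢0) = inv-unique (a * b) (inv a * inv b) (begin
    a * b * (inv a * inv b)     ≡⟨ solve 4 (λ a b i j → a :* b :* (i :* j) := (a :* i) :* (b :* j)) refl a b (inv a) (inv b) ⟩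
    (a * inv a) * (b * inv b)   ≡⟨ cong₂ _*_ (inv-cancelʳ a a≢0) (inv-cancelʳ b b≢0) ⟩
    1ℚ                          ∎)

cross-multiply : ∀ a b c d → b ≢ 0ℚ → d ≢ 0ℚ → a * d ≡ c * b → a * inv b ≡ c * inv d
cross-multiply a b c d b≢0 d≢0 ad≡cb = begin
  a * inv b                   ≡⟨ *-unitʳ-by (a * inv b) (inv-cancelʳ d d≢0) ⟩
  a * inv b * (d * inv d)     ≡⟨ solve 4 (λ a i d j → a :* i :* (d :* j) := (a :* d) :* i :* j) refl a (inv b) d (inv d) ⟩
  (a * d) * inv b * inv d     ≡⟨ cong (λ t → t * inv b * inv d) ad≡cb ⟩
  (c * b) * inv b * inv d     ≡⟨ solve 4 (λ c b i j → c :* b :* i :* j := c :* j :* (b :* i)) refl c b (inv b) (inv d) ⟩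
  c * inv d * (b * inv b)     ≡⟨ cong (c * inv d *_) (inv-cancelʳ b b≢0) ⟩
  c * inv d * 1ℚ              ≡⟨ ℚP.*-identityʳ (c * inv d) ⟩
  c * inv d                   ∎

sub≡0⇒≡ : ∀ a b → a - b ≡ 0ℚ → a ≡ b
sub≡0⇒≡ a b a-b≡0 = begin
  a              ≡⟨ solve 2 (λ a b → a := (a :- b) :+ b) refl a b ⟩
  (a - b) + b    ≡⟨ cong (_+ b) a-b≡0 ⟩
  0ℚ + b         ≡⟨ ℚP.+-identityˡ b ⟩
  b              ∎

prodFin-cong : ∀ n {f g} → (∀ d → f d ≡ g d) → prodFin n f ≡ prodFin n g
prodFin-cong zero    f≡g = refl
prodFin-cong (suc n) f≡g = cong₂ _*_ (f≡g zero) (prodFin-cong n (λ d → f≡g (suc d)))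

prodFin-one : ∀ n → prodFin n (λ _ → 1ℚ) ≡ 1ℚ
prodFin-one zero    = refl
prodFin-one (suc n) = cong (1ℚ *_) (prodFin-one n)

prodFin-* : ∀ n f g → prodFin n (λ d → f d * g d) ≡ prodFin n f * prodFin n g
prodFin-* zero    f g = refl
prodFin-* (suc n) f g = begin
  f zero * g zero * prodFin n (λ d → f (suc d) * g (suc d))
    ≡⟨ cong (f zero * g zero *_) (prodFin-* n (λ d → f (suc d)) (λ d → g (suc d))) ⟩
  f zero * g zero * (F * G)
    ≡⟨ solve 4 (λ a b c d → a :* b :* (c :* d) := a :* c :* (b :* d)) refl (f zero) (g zero) F G ⟩
  f zero * F * (g zero * G) ∎
  where
  F = prodFin n (λ d → f (suc d))
  G = prodFin n (λ d → g (suc d))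

inv-prodFin : ∀ n f → inv (prodFin n f) ≡ prodFin n (λ d → inv (f d))
inv-prodFin zero    f = refl
inv-prodFin (suc n) f =
  trans (inv-* (f zero) _) (cong (inv (f zero) *_) (inv-prodFin n (λ d → f (suc d))))

sumUpTo-cong : ∀ N f g → (∀ j → j ≤ N → f j ≡ g j) → sumUpTo N f ≡ sumUpTo N g
sumUpTo-cong zero    f g f≡g = f≡g 0 z≤n
sumUpTo-cong (suc N) f g f≡g =
  cong₂ _+_ (sumUpTo-cong N f g (λ j j≤N → f≡g j (ℕP.m≤n⇒m≤1+n j≤N))) (f≡g (suc N) ℕP.≤-refl)

sumUpTo-shift : ∀ N f → sumUpTo (suc N) f ≡ f 0 + sumUpTo N (λ j → f (suc j))
sumUpTo-shift zero    f = refl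
sumUpTo-shift (suc N) f = begin
  sumUpTo (suc N) f + f (suc (suc N))
    ≡⟨ cong (_+ f (suc (suc N))) (sumUpTo-shift N f) ⟩
  f 0 + sumUpTo N (λ j → f (suc j)) + f (suc (suc N))
    ≡⟨ ℚP.+-assoc (f 0) _ _ ⟩
  f 0 + (sumUpTo N (λ j → f (suc j)) + f (suc (suc N))) ∎

sumUpTo-sub : ∀ N f g → sumUpTo N (λ j → f j - g j) ≡ sumUpTo N f - sumUpTo N g
sumUpTo-sub zero    f g = refl
sumUpTo-sub (suc N) f g = trans (cong (_+ (f (suc N) - g (suc N))) (sumUpTo-sub N f g))
  (solve 4 (λ a b c d → (a :- b) :+ (c :- d) := (a :+ c) :- (b :+ d)) refl
     (sumUpTo N f) (sumUpTo N g) (f (suc N)) (g (suc N)))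

falling-+ : ∀ x j k → falling x (j ℕ.+ k) ≡ falling x j * falling (x - ℕtoℚ j) k
falling-+ x j zero rewrite ℕP.+-identityʳ j = sym (ℚP.*-identityʳ (falling x j))
falling-+ x j (suc k) rewrite ℕP.+-suc j k = begin
  falling x (j ℕ.+ k) * (x - ℕtoℚ (j ℕ.+ k))
    ≡⟨ cong₂ _*_ (falling-+ x j k) (cong (λ t → x - t) (ℤtoℚ-+ (+ j) (+ k))) ⟩
  falling x j * falling (x - ℕtoℚ j) k * (x - (ℕtoℚ j + ℕtoℚ k))
    ≡⟨ solve 5 (λ a b x j k → a :* b :* (x :- (j :+ k)) := a :* (b :* ((x :- j) :- k))) refl
         (falling x j) (falling (x - ℕtoℚ j) k) x (ℕtoℚ j) (ℕtoℚ k) ⟩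
  falling x j * (falling (x - ℕtoℚ j) k * ((x - ℕtoℚ j) - ℕtoℚ k)) ∎

-- Both sides equal falling x (j + k).
falling-exchange : ∀ x j k →
  falling x j * falling (x - ℕtoℚ j) k ≡ falling x k * falling (x - ℕtoℚ k) j
falling-exchange x j k = begin
  falling x j * falling (x - ℕtoℚ j) k   ≡⟨ falling-+ x j k ⟨
  falling x (j ℕ.+ k)                     ≡⟨ cong (falling x) (ℕP.+-comm j k) ⟩
  falling x (k ℕ.+ j)                     ≡⟨ falling-+ x k j ⟩
  falling x k * falling (x - ℕtoℚ k) j   ∎

falling-succˡ : ∀ x k → falling x (suc k) ≡ x * falling (x - 1ℚ) k
falling-succˡ x k = trans (falling-+ x 1 k)
  (cong (_* falling (x - 1ℚ) k) (solve 1 (λ x → con 1ℚ :* (x :- con 0ℚ) := x) refl x))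

rising-succˡ : ∀ a j → rising a (suc j) ≡ a * rising (a + 1ℚ) j
rising-succˡ a zero    = solve 1 (λ a → con 1ℚ :* (a :+ con 0ℚ) := a :* con 1ℚ) refl a
rising-succˡ a (suc j) = begin
  rising a (suc j) * (a + ℕtoℚ (suc j))
    ≡⟨ cong₂ _*_ (rising-succˡ a j) (cong (λ t → a + t) (ℕtoℚ-suc j)) ⟩
  a * rising (a + 1ℚ) j * (a + (ℕtoℚ j + 1ℚ))
    ≡⟨ solve 3 (λ a r j → a :* r :* (a :+ (j :+ con 1ℚ)) := a :* (r :* ((a :+ con 1ℚ) :+ j))) refl
         a (rising (a + 1ℚ) j) (ℕtoℚ j) ⟩
  a * (rising (a + 1ℚ) j * ((a + 1ℚ) + ℕtoℚ j)) ∎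

rising-neg : ∀ a j → rising a j ≡ pow (- 1ℚ) j * falling (- a) j
rising-neg a zero    = refl
rising-neg a (suc j) = trans (cong (_* (a + ℕtoℚ j)) (rising-neg a j))
  (solve 4 (λ σ f a j → σ :* f :* (a :+ j) := σ :* con (- 1ℚ) :* (f :* (:- a :- j))) refl
     (pow (- 1ℚ) j) (falling (- a) j) a (ℕtoℚ j))

pow-one : ∀ j → pow 1ℚ j ≡ 1ℚ
pow-one zero    = refl
pow-one (suc j) = cong (_* 1ℚ) (pow-one j)

pow-≢0 : ∀ t j → t ≢ 0ℚ → pow t j ≢ 0ℚ
pow-≢0 t zero    t≢0 = ℚP.1≢0
pow-≢0 t (suc j) t≢0 = *-≢0 (pow-≢0 t j t≢0) t≢0

falling-≢0 : ∀ x k → (∀ i → i < k → x ≢ ℕtoℚ i) → falling x k ≢ 0ℚ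
falling-≢0 x zero    x∉ = ℚP.1≢0
falling-≢0 x (suc k) x∉ = *-≢0 (falling-≢0 x k (λ i i<k → x∉ i (ℕP.m<n⇒m<1+n i<k)))
                                (λ x-k≡0 → x∉ k ℕP.≤-refl (sub≡0⇒≡ x (ℕtoℚ k) x-k≡0))

falling-ℕ-≢0 : ∀ s k → k ≤ s → falling (ℕtoℚ s) k ≢ 0ℚ
falling-ℕ-≢0 s k k≤s = falling-≢0 (ℕtoℚ s) k
  (λ i i<k s≡i → ℕP.<⇒≢ (ℕP.<-≤-trans i<k k≤s) (sym (ℕtoℚ-injective s i s≡i)))

rising-neg-neg : ∀ x j → rising (- x) j ≡ pow (- 1ℚ) j * falling x j
rising-neg-neg x j = trans (rising-neg (- x) j)
  (cong (λ y → pow (- 1ℚ) j * falling y j) (solve 1 (λ x → :- (:- x) := x) refl x))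

rising-neg-ℕ-≢0 : ∀ s j → j ≤ s → rising (- ℕtoℚ s) j ≢ 0ℚ
rising-neg-ℕ-≢0 s j j≤s rising≡0 =
  *-≢0 (pow-≢0 (- 1ℚ) j (λ ())) (falling-ℕ-≢0 s j j≤s) (trans (sym (rising-neg-neg (ℕtoℚ s) j)) rising≡0)

factorial-≢0 : ∀ k → ℕtoℚ (k !) ≢ 0ℚ
factorial-≢0 k k!≡0 = ℕ.≢-nonZero⁻¹ (k !) {{ℕP._!≢0 k}} (ℕtoℚ-injective (k !) 0 k!≡0)

binom-ℕ-≢0 : ∀ s k → k ≤ s → binom (+ s) k ≢ 0ℚ
binom-ℕ-≢0 s k k≤s = *-≢0 (falling-ℕ-≢0 s k k≤s) (inv-≢0 _ (factorial-≢0 k))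

binom-pred : ∀ s k → binom s k ≢ 0ℚ →
  binom (s ℤ.- 1ℤ) k ≡ (1ℚ - ℕtoℚ k * inv (ℤtoℚ s)) * binom s k
binom-pred s zero    _ =
  sym (trans (cong (λ t → (1ℚ - t) * binom s 0) (ℚP.*-zeroˡ (inv (ℤtoℚ s)))) (ℚP.*-identityˡ (binom s 0)))
binom-pred s (suc k) binom≢0 = begin
  falling (ℤtoℚ (s ℤ.- 1ℤ)) (suc k) * iK
    ≡⟨ cong (λ t → falling t (suc k) * iK) (ℤtoℚ-sub s 1ℤ) ⟩
  F′ * iK
    ≡⟨ *-unitʳ-by (F′ * iK) (inv-cancelʳ S S≢0) ⟩
  F′ * iK * (S * iS)
    ≡⟨ solve 4 (λ F′ iK S iS → F′ :* iK :* (S :* iS) := iS :* (S :* F′) :* iK) refl F′ iK S iS ⟩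
  iS * (S * F′) * iK
    ≡⟨ cong (λ t → iS * t * iK) (falling-succˡ S (suc k)) ⟨
  iS * (F * (S - κ)) * iK
    ≡⟨ solve 5 (λ iS F S κ iK → iS :* (F :* (S :- κ)) :* iK := (S :* iS :- κ :* iS) :* (F :* iK)) refl iS F S κ iK ⟩
  (S * iS - κ * iS) * (F * iK)
    ≡⟨ cong (λ t → (t - κ * iS) * (F * iK)) (inv-cancelʳ S S≢0) ⟩
  (1ℚ - κ * iS) * (F * iK) ∎
  where
  S  = ℤtoℚ s
  iS = inv S
  κ  = ℕtoℚ (suc k)
  iK = inv (ℕtoℚ (suc k !))
  F  = falling S (suc k)
  F′ = falling (S - 1ℚ) (suc k)
  -- binom(s, k+1) has the factor s
  S≢0 : S ≢ 0ℚ
  S≢0 S≡0 = binom≢0 (begin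
    F * iK                     ≡⟨ cong (_* iK) (falling-succˡ S k) ⟩
    S * falling (S - 1ℚ) k * iK ≡⟨ cong (λ t → t * falling (S - 1ℚ) k * iK) S≡0 ⟩
    0ℚ * falling (S - 1ℚ) k * iK ≡⟨ cong (_* iK) (ℚP.*-zeroˡ (falling (S - 1ℚ) k)) ⟩
    0ℚ * iK                    ≡⟨ ℚP.*-zeroˡ iK ⟩
    0ℚ                         ∎)

inv-binom-pred : ∀ s k → binom s k ≢ 0ℚ → binom (s ℤ.- 1ℤ) k ≢ 0ℚ →
  inv (binom s k) ≡ (1ℚ - ℕtoℚ k * inv (ℤtoℚ s)) * inv (binom (s ℤ.- 1ℤ) k)
inv-binom-pred s k binom≢0 binom′≢0 =
  trans (sym (ℚP.*-identityˡ (inv (binom s k))))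
    (cross-multiply 1ℚ (binom s k) (1ℚ - ℕtoℚ k * inv (ℤtoℚ s)) (binom (s ℤ.- 1ℤ) k) binom≢0 binom′≢0
      (trans (ℚP.*-identityˡ (binom (s ℤ.- 1ℤ) k)) (binom-pred s k binom≢0)))

binom-shift-ratio : ∀ s j k → j ≤ s → k ≤ s →
  binom (+ s ℤ.- + j) k * inv (binom (+ s) k)
    ≡ rising (ℕtoℚ k - ℕtoℚ s) j * inv (rising (- ℕtoℚ s) j)
binom-shift-ratio s j k j≤s k≤s =
  cross-multiply (binom (+ s ℤ.- + j) k) (binom (+ s) k) (rising (κ - x) j) (rising (- x) j)
                 (binom-ℕ-≢0 s k k≤s) (rising-neg-ℕ-≢0 s j j≤s) (begin
    falling (ℤtoℚ (+ s ℤ.- + j)) k * iK * rising (- x) j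
      ≡⟨ cong₂ (λ y z → falling y k * iK * z) (ℤtoℚ-sub (+ s) (+ j)) (rising-neg-neg x j) ⟩
    falling (x - ℕtoℚ j) k * iK * (σ * falling x j)
      ≡⟨ solve 4 (λ A iK σ B → A :* iK :* (σ :* B) := σ :* (B :* A) :* iK) refl
           (falling (x - ℕtoℚ j) k) iK σ (falling x j) ⟩
    σ * (falling x j * falling (x - ℕtoℚ j) k) * iK
      ≡⟨ cong (λ t → σ * t * iK) (falling-exchange x j k) ⟩
    σ * (falling x k * falling (x - κ) j) * iK
      ≡⟨ solve 4 (λ σ B G iK → σ :* (B :* G) :* iK := σ :* G :* (B :* iK)) refl
           σ (falling x k) (falling (x - κ) j) iK ⟩
    σ * falling (x - κ) j * (falling x k * iK)
      ≡⟨ cong (λ y → σ * falling y j * (falling x k * iK)) (solve 2 (λ κ x → :- (κ :- x) := x :- κ) refl κ x) ⟨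
    σ * falling (- (κ - x)) j * (falling x k * iK)
      ≡⟨ cong (_* (falling x k * iK)) (rising-neg (κ - x) j) ⟨
    rising (κ - x) j * (falling x k * iK) ∎)
  where
  x  = ℕtoℚ s
  κ  = ℕtoℚ k
  iK = inv (ℕtoℚ (k !))
  σ  = pow (- 1ℚ) j

nablaPow-cong : ∀ r {f g} → (∀ x → f x ≡ g x) → ∀ y → nablaPow r f y ≡ nablaPow r g y
nablaPow-cong zero    f≡g y = f≡g y
nablaPow-cong (suc r) f≡g y = cong₂ _-_ (nablaPow-cong r f≡g y) (nablaPow-cong r f≡g (y ℤ.- 1ℤ))

nablaPow-scale : ∀ r c g y → nablaPow r (λ x → c * g x) y ≡ c * nablaPow r g y
nablaPow-scale zero    c g y = refl
nablaPow-scale (suc r) c g y =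
  trans (cong₂ _-_ (nablaPow-scale r c g y) (nablaPow-scale r c g (y ℤ.- 1ℤ)))
    (solve 3 (λ c a b → c :* a :- c :* b := c :* (a :- b)) refl c (nablaPow r g y) (nablaPow r g (y ℤ.- 1ℤ)))

-- Newton coefficient (-r)^{(j)}/j!, which equals (-1)^j binom(r,j).
newtonCoef : ℕ → ℕ → ℚ
newtonCoef r j = rising (- ℕtoℚ r) j * inv (ℕtoℚ (j !))

-- The coefficients vanish beyond j = r, as (-r)^{(r+1)} contains the factor -r + r.
newtonCoef-vanish : ∀ r → newtonCoef r (suc r) ≡ 0ℚ
newtonCoef-vanish r = begin
  rising (- ℕtoℚ r) r * (- ℕtoℚ r + ℕtoℚ r) * i
    ≡⟨ cong (λ t → rising (- ℕtoℚ r) r * t * i) (ℚP.+-inverseˡ (ℕtoℚ r)) ⟩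
  rising (- ℕtoℚ r) r * 0ℚ * i
    ≡⟨ cong (_* i) (ℚP.*-zeroʳ (rising (- ℕtoℚ r) r)) ⟩
  0ℚ * i
    ≡⟨ ℚP.*-zeroˡ i ⟩
  0ℚ ∎
  where i = inv (ℕtoℚ (suc r !))

inv-factorial-suc : ∀ j → inv (ℕtoℚ (suc j !)) ≡ inv (ℕtoℚ (suc j)) * inv (ℕtoℚ (j !))
inv-factorial-suc j = trans (cong inv (ℕtoℚ-* (suc j) (j !))) (inv-* (ℕtoℚ (suc j)) (ℕtoℚ (j !)))

-- Peeling one factor off each
-- side gives newtonCoef (r+1) (j+1) = -(r+1)/(j+1) · newtonCoef r j and
-- newtonCoef r (j+1) = (j-r)/(j+1) · newtonCoef r j, and (j-r) - (j+1) = -(r+1).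
newtonCoef-pascal : ∀ r j → newtonCoef (suc r) (suc j) ≡ newtonCoef r (suc j) - newtonCoef r j
newtonCoef-pascal r j = begin
  rising (- ℕtoℚ (suc r)) (suc j) * inv (ℕtoℚ (suc j !))
    ≡⟨ cong₂ _*_ (trans (rising-succˡ (- ℕtoℚ (suc r)) j)
                        (cong₂ (λ a b → - a * rising b j) (ℕtoℚ-suc r) shift))
                 (inv-factorial-suc j) ⟩
  - (rℚ + 1ℚ) * R * (i * I)
    ≡⟨ solve 5 (λ rℚ R i I jℚ → :- (rℚ :+ con 1ℚ) :* R :* (i :* I)
                              := R :* (:- rℚ :+ jℚ) :* (i :* I) :- R :* I :* ((jℚ :+ con 1ℚ) :* i))
         refl rℚ R i I jℚ ⟩
  R * (- rℚ + jℚ) * (i * I) - R * I * ((jℚ + 1ℚ) * i)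
    ≡⟨ cong (λ t → R * (- rℚ + jℚ) * (i * I) - R * I * t) jℚ+1·i≡1 ⟩
  R * (- rℚ + jℚ) * (i * I) - R * I * 1ℚ
    ≡⟨ cong₂ _-_ (cong (R * (- rℚ + jℚ) *_) (sym (inv-factorial-suc j))) (ℚP.*-identityʳ (R * I)) ⟩
  R * (- rℚ + jℚ) * inv (ℕtoℚ (suc j !)) - R * I ∎
  where
  rℚ = ℕtoℚ r
  jℚ = ℕtoℚ j
  R = rising (- ℕtoℚ r) j
  I = inv (ℕtoℚ (j !))
  i = inv (ℕtoℚ (suc j))
  shift : - ℕtoℚ (suc r) + 1ℚ ≡ - ℕtoℚ r
  shift = trans (cong (λ t → - t + 1ℚ) (ℕtoℚ-suc r)) (solve 1 (λ r → :- (r :+ con 1ℚ) :+ con 1ℚ := :- r) refl rℚ)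
  jℚ+1·i≡1 : (jℚ + 1ℚ) * i ≡ 1ℚ
  jℚ+1·i≡1 = trans (cong (_* i) (sym (ℕtoℚ-suc j)))
                  (inv-cancelʳ (ℕtoℚ (suc j)) (λ eq → ℕP.1+n≢0 (ℕtoℚ-injective (suc j) 0 eq)))

nablaPow-newton : ∀ r f s → nablaPow r f s ≡ sumUpTo r (λ j → newtonCoef r j * f (s ℤ.- + j))
nablaPow-newton zero    f s = sym (trans (ℚP.*-identityˡ (f (s ℤ.- + 0))) (cong f (ℤP.+-identityʳ s)))
nablaPow-newton (suc r) f s = begin
  nablaPow r f s - nablaPow r f (s ℤ.- 1ℤ)
    ≡⟨ cong₂ _-_ (nablaPow-newton r f s) (nablaPow-newton r f (s ℤ.- 1ℤ)) ⟩
  A - B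
    ≡⟨ cong (_- B) A-split ⟩
  (c₀g₀ + T) - B
    ≡⟨ solve 3 (λ a t b → (a :+ t) :- b := a :+ (t :- b)) refl c₀g₀ T B ⟩
  c₀g₀ + (T - B)
    ≡⟨ cong (λ t → c₀g₀ + t) (sumUpTo-sub r (λ j → newtonCoef r (suc j) * g (suc j)) (λ j → newtonCoef r j * h j)) ⟨
  c₀g₀ + sumUpTo r (λ j → newtonCoef r (suc j) * g (suc j) - newtonCoef r j * h j)
    ≡⟨ cong (λ t → c₀g₀ + t) (sumUpTo-cong r _ _ (λ j _ → merge j)) ⟩
  c₀g₀ + sumUpTo r (λ j → newtonCoef (suc r) (suc j) * g (suc j))
    ≡⟨ sumUpTo-shift r (λ j → newtonCoef (suc r) j * g j) ⟨
  sumUpTo (suc r) (λ j → newtonCoef (suc r) j * g j) ∎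
  where
  open ℤSolver.+-*-Solver using () renaming (solve to solveℤ; _:=_ to _:=ℤ_; _:+_ to _:+ℤ_; _:-_ to _:-ℤ_; con to conℤ)
  g h : ℕ → ℚ
  g j = f (s ℤ.- + j)
  h j = f (s ℤ.- 1ℤ ℤ.- + j)
  A = sumUpTo r (λ j → newtonCoef r j * g j)
  B = sumUpTo r (λ j → newtonCoef r j * h j)
  T = sumUpTo r (λ j → newtonCoef r (suc j) * g (suc j))
  c₀g₀ = newtonCoef r 0 * g 0
  -- A gains the vanishing term j = r+1 and then splits off its j = 0 term
  -- (newtonCoef r 0 and newtonCoef (r+1) 0 both compute to 1, so c₀g₀ is
  -- also the j = 0 term of the final sum)
  A-split : A ≡ c₀g₀ + T
  A-split = begin
    A                                           ≡⟨ ℚP.+-identityʳ A ⟨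
    A + 0ℚ                                      ≡⟨ cong (λ t → A + t) (trans (cong (_* g (suc r)) (newtonCoef-vanish r)) (ℚP.*-zeroˡ (g (suc r)))) ⟨
    A + newtonCoef r (suc r) * g (suc r)        ≡⟨ sumUpTo-shift r (λ j → newtonCoef r j * g j) ⟩
    c₀g₀ + T                                    ∎
  h≡g : ∀ j → h j ≡ g (suc j)
  h≡g j = cong f (solveℤ 2 (λ s j → s :-ℤ conℤ 1ℤ :-ℤ j :=ℤ s :-ℤ (conℤ 1ℤ :+ℤ j)) refl s (+ j))
  merge : ∀ j → newtonCoef r (suc j) * g (suc j) - newtonCoef r j * h j ≡ newtonCoef (suc r) (suc j) * g (suc j)
  merge j = begin
    newtonCoef r (suc j) * g (suc j) - newtonCoef r j * h j
      ≡⟨ cong (λ t → newtonCoef r (suc j) * g (suc j) - newtonCoef r j * t) (h≡g j) ⟩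
    newtonCoef r (suc j) * g (suc j) - newtonCoef r j * g (suc j)
      ≡⟨ solve 3 (λ a b x → a :* x :- b :* x := (a :- b) :* x) refl (newtonCoef r (suc j)) (newtonCoef r j) (g (suc j)) ⟩
    (newtonCoef r (suc j) - newtonCoef r j) * g (suc j)
      ≡⟨ cong (_* g (suc j)) (newtonCoef-pascal r j) ⟨
    newtonCoef (suc r) (suc j) * g (suc j) ∎

normalisedProduct : {n : ℕ} → (Fin n → ℕ) → ℤ → ℤ → ℚ
normalisedProduct {n} k s x = prodFin n (λ d → binom x (k d) * inv (binom s (k d)))

rho-zero : ∀ {n} (k : Fin n → ℕ) (s : ℤ) → (∀ d → binom s (k d) ≢ 0ℚ) → rho k 0 s ≡ 1ℚ
rho-zero {n} k s binom≢0 =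
  trans (prodFin-cong n (λ d → inv-cancelʳ _ (binom≢0 d))) (prodFin-one n)

normalisedProduct-pred : ∀ {n} (k : Fin n → ℕ) (s : ℤ) →
  (∀ d → binom s (k d) ≢ 0ℚ) → (∀ d → binom (s ℤ.- 1ℤ) (k d) ≢ 0ℚ) → ∀ x →
  normalisedProduct k s x
    ≡ prodFin n (λ d → 1ℚ - ℕtoℚ (k d) * inv (ℤtoℚ s)) * normalisedProduct k (s ℤ.- 1ℤ) x
normalisedProduct-pred {n} k s binom≢0 binom′≢0 x =
  trans (prodFin-cong n factor) (prodFin-* n c (λ d → binom x (k d) * inv (binom (s ℤ.- 1ℤ) (k d))))
  where
  c : Fin n → ℚ
  c d = 1ℚ - ℕtoℚ (k d) * inv (ℤtoℚ s)
  factor : ∀ d → binom x (k d) * inv (binom s (k d)) ≡ c d * (binom x (k d) * inv (binom (s ℤ.- 1ℤ) (k d)))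
  factor d = trans (cong (binom x (k d) *_) (inv-binom-pred s (k d) (binom≢0 d) (binom′≢0 d)))
    (solve 3 (λ b c i → b :* (c :* i) := c :* (b :* i)) refl (binom x (k d)) (c d) (inv (binom (s ℤ.- 1ℤ) (k d))))

-- ρ_k(r+1,s) = ∇^r F_s(s) - ∇^r F_s(s-1), where F_s is the product normalised
-- at s; the second term is ∏_d (1 - k_d/s) · ρ_k(r,s-1).
rho-recursion : ∀ {n} (k : Fin n → ℕ) (r : ℕ) (s : ℤ) →
  (∀ d → binom s (k d) ≢ 0ℚ) → (∀ d → binom (s ℤ.- 1ℤ) (k d) ≢ 0ℚ) →
  rho k (suc r) s ≡ rho k r s - prodFin n (λ d → 1ℚ - ℕtoℚ (k d) * inv (ℤtoℚ s)) * rho k r (s ℤ.- 1ℤ)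
rho-recursion {n} k r s binom≢0 binom′≢0 = cong (λ t → rho k r s - t) (begin
  nablaPow r (normalisedProduct k s) (s ℤ.- 1ℤ)
    ≡⟨ nablaPow-cong r (normalisedProduct-pred k s binom≢0 binom′≢0) (s ℤ.- 1ℤ) ⟩
  nablaPow r (λ x → C * normalisedProduct k (s ℤ.- 1ℤ) x) (s ℤ.- 1ℤ)
    ≡⟨ nablaPow-scale r C (normalisedProduct k (s ℤ.- 1ℤ)) (s ℤ.- 1ℤ) ⟩
  C * rho k r (s ℤ.- 1ℤ) ∎)
  where C = prodFin n (λ d → 1ℚ - ℕtoℚ (k d) * inv (ℤtoℚ s))

rho-term : ∀ {n} (k : Fin n → ℕ) (r s j : ℕ) → (∀ d → k d ≤ r) → r ≤ s → j ≤ r →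
  newtonCoef r j * normalisedProduct k (+ s) (+ s ℤ.- + j)
    ≡ prodFin (suc n) (λ i → rising (upperParams k r s i) j)
        * inv (prodFin n (λ _ → rising (- ℕtoℚ s) j)) * pow 1ℚ j * inv (ℕtoℚ (j !))
rho-term {n} k r s j k≤r r≤s j≤r = begin
  R * I * normalisedProduct k (+ s) (+ s ℤ.- + j)
    ≡⟨ cong (R * I *_) ratios ⟩
  R * I * (P * inv Q)
    ≡⟨ solve 4 (λ R I P iQ → R :* I :* (P :* iQ) := R :* P :* iQ :* con 1ℚ :* I) refl R I P (inv Q) ⟩
  R * P * inv Q * 1ℚ * I
    ≡⟨ cong (λ t → R * P * inv Q * t * I) (pow-one j) ⟨
  R * P * inv Q * pow 1ℚ j * I ∎
  where
  R = rising (- ℕtoℚ r) j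
  I = inv (ℕtoℚ (j !))
  P = prodFin n (λ d → rising (ℕtoℚ (k d) - ℕtoℚ s) j)
  Q = prodFin n (λ _ → rising (- ℕtoℚ s) j)
  ratios : normalisedProduct k (+ s) (+ s ℤ.- + j) ≡ P * inv Q
  ratios = begin
    normalisedProduct k (+ s) (+ s ℤ.- + j)
      ≡⟨ prodFin-cong n (λ d → binom-shift-ratio s j (k d) (ℕP.≤-trans j≤r r≤s) (ℕP.≤-trans (k≤r d) r≤s)) ⟩
    prodFin n (λ d → rising (ℕtoℚ (k d) - ℕtoℚ s) j * inv (rising (- ℕtoℚ s) j))
      ≡⟨ prodFin-* n (λ d → rising (ℕtoℚ (k d) - ℕtoℚ s) j) (λ _ → inv (rising (- ℕtoℚ s) j)) ⟩
    P * prodFin n (λ _ → inv (rising (- ℕtoℚ s) j))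
      ≡⟨ cong (P *_) (inv-prodFin n (λ _ → rising (- ℕtoℚ s) j)) ⟨
    P * inv Q ∎

rho-hypergeometric : ∀ {n} (k : Fin n → ℕ) (r s : ℕ) → (∀ d → k d ≤ r) → r ≤ s →
  rho k r (+ s) ≡ hypF (suc n) n (upperParams k r s) (λ _ → - ℕtoℚ s) r 1ℚ
rho-hypergeometric k r s k≤r r≤s =
  trans (nablaPow-newton r (normalisedProduct k (+ s)) (+ s))
        (sumUpTo-cong r _ _ (λ j j≤r → rho-term k r s j k≤r r≤s j≤r))

theorem2p4 : (n : ℕ) (k : Fin n → ℕ) →
    ((s : ℤ) → (∀ d → binom s (k d) ≢ 0ℚ) → rho k 0 s ≡ 1ℚ)
  × ((r : ℕ) (s : ℤ) → (∀ d → binom s (k d) ≢ 0ℚ) → (∀ d → binom (s ℤ.- 1ℤ) (k d) ≢ 0ℚ) →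
      rho k (suc r) s ≡ rho k r s - prodFin n (λ d → 1ℚ - ℕtoℚ (k d) * inv (ℤtoℚ s)) * rho k r (s ℤ.- 1ℤ))
  × ((r s : ℕ) → (∀ d → k d ≤ r) → r ≤ s →
      rho k r (+ s) ≡ hypF (suc n) n (upperParams k r s) (λ _ → - ℕtoℚ s) r 1ℚ)
theorem2p4 n k = rho-zero k , rho-recursion k , rho-hypergeometric k
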